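{- Let $\lambda$ be a Young diagram, let $\mathcal H_\lambda=\{h(i,j):(i,j)\in\lambda\}$ be the multiset of hook numbers and $\mathcal H^\ast_\lambda=\{h^\ast(i,j):(i,j)\in\lambda\}$ the multiset of anti-hook numbers. Then $\mathcal H_\lambda$ majorizes $\mathcal H^\ast_\lambda$.
   Context: Let $\lambda=(\lambda_1\ge\dots\ge\lambda_\ell>0)$ be an integer partition with conjugate $\lambda'$; its Young diagram is the set of squares $(i,j)$ with $1\le i\le\ell$, $1\le j\le\lambda_i$. The hook length is $h(i,j)=\lambda_i-i+\lambda'_j-j+1$ and the anti-hook length is $h^\ast(i,j)=i+j-1$. Majorization: for two multisets $\mathcal A,\mathcal B$ of $n$ real numbers, let $a_1\ge\dots\ge a_n$ and $b_1\ge\dots\ge b_n$ be their elements in non-increasing order. $\mathcal A$ majorizes $\mathcal B$ if $a_1+\dots+a_k\ge b_1+\dots+b_k$ for all $1\le k<n$ and $a_1+\dots+a_n=b_1+\dots+b_n$. -}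

module Defs where

open import Data.Nat using (_≤?_; ℕ; zero; suc; _+_; _∸_; _≤_; _≥_; _<_)
open import Data.Nat.Properties using (≤-decTotalOrder)
open import Data.List using (List; []; _∷_; length; map; take; concatMap; upTo; reverse; lookup)
open import Data.Nat.ListAction using (sum)
open import Data.List.Relation.Unary.All using (All)
open import Data.List.Relation.Unary.Linked using (Linked)
open import Relation.Binary.PropositionalEquality using (_≡_)
open import Relation.Nullary using (yes; no)
open import Data.Product using (_×_; _,_)
open import Data.List.Sort.MergeSort ≤-decTotalOrder using (mergeSort)
open import Data.List.Sort.Base using (SortingAlgorithm)

IsPartition : List ℕ → Set
IsPartition λs = Linked _≥_ λs × All (λ x → 0 < x) λs

-- Part λ_i (1-indexed), 0 beyond the length.
part : List ℕ → ℕ → ℕ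
part []       _             = 0
part (x ∷ xs) zero          = 0
part (x ∷ xs) (suc zero)    = x
part (x ∷ xs) (suc (suc i)) = part xs (suc i)

conjPart : List ℕ → ℕ → ℕ
conjPart []       j = 0
conjPart (x ∷ xs) j with j ≤? x
... | yes _ = suc (conjPart xs j)
... | no  _ = conjPart xs j

-- Young diagram: all squares (i,j), 1 ≤ i ≤ ℓ, 1 ≤ j ≤ λ_i (1-indexed).
cells : List ℕ → List (ℕ × ℕ)
cells λs = concatMap (λ i → map (λ j → (suc i , suc j)) (upTo (part λs (suc i))))
                     (upTo (length λs))

-- h(i,j) = λ_i - i + λ'_j - j + 1, computed as (λ_i + λ'_j + 1) ∸ (i + j) (exact on cells).
hook : List ℕ → ℕ × ℕ → ℕ
hook λs (i , j) = (part λs i + conjPart λs j + 1) ∸ (i + j)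

antiHook : ℕ × ℕ → ℕ
antiHook (i , j) = i + j ∸ 1

hooks : List ℕ → List ℕ
hooks λs = map (hook λs) (cells λs)

antiHooks : List ℕ → List ℕ
antiHooks λs = map antiHook (cells λs)

sortDesc : List ℕ → List ℕ
sortDesc xs = reverse (SortingAlgorithm.sort mergeSort xs)

Majorizes : List ℕ → List ℕ → Set
Majorizes A B =
  length A ≡ length B
  × (∀ k → k < length A → sum (take k (sortDesc B)) ≤ sum (take k (sortDesc A)))
  × sum A ≡ sum B

-- For multisets of naturals of equal size and sum, A majorizes B as soon as every excess
-- function excess t X = Σ (x ∸ t) is larger on A than on B: the sum of the k largest
-- entries of A is k t + excess t A for t its (k+1)-st largest entry, while for B it is at
-- most k t + excess t B for every t.
--
-- Let μ be λ with its first column (of length ℓ) removed. The hooks of λ are those of μ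
-- together with the first-column hooks λᵢ + ℓ - i, and the anti-hooks of λ are those of μ
-- together with the anti-hooks λᵢ + i - 1 of the last squares of the rows. As λ is
-- decreasing and x ↦ x ∸ t is convex, the rearrangement inequality gives
-- Σᵢ (λᵢ + i - 1 ∸ t) ≤ Σᵢ (λᵢ + ℓ - i ∸ t), with equality for t = 0, and induction on the
-- number of columns concludes.

module Submission where

open import Defs
open import Data.Nat using (ℕ; zero; suc; _+_; _*_; _∸_; _≤_; _<_; _≥_; z≤n; s≤s; z<s; s<s; pred)
open import Data.Nat.Properties
open import Data.Nat.ListAction using (sum)
open import Data.Nat.ListAction.Properties using (sum-++; sum-↭)
open import Data.List using (List; []; _∷_; length; map; take; reverse; reverseAcc; concatMap; applyUpTo; upTo)
open import Data.List.Properties using (map-id; length-map; map-∘; map-concatMap)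
open import Data.List.Relation.Unary.All as All using (All; []; _∷_)
import Data.List.Relation.Unary.All.Properties as All
open import Data.List.Relation.Unary.Linked as Linked using (Linked; []; [-]; _∷_)
import Data.List.Relation.Unary.Linked.Properties as Linked
open import Data.List.Relation.Binary.Permutation.Propositional using (_↭_; ↭-trans)
open import Data.List.Relation.Binary.Permutation.Propositional.Properties
  using (↭-reverse; map⁺; ↭-length)
open import Data.List.Sort.MergeSort ≤-decTotalOrder using (mergeSort)
open import Data.List.Sort.Base using (SortingAlgorithm)
open import Data.Product using (_×_; _,_; ∃-syntax; map₂; proj₂)
open import Data.Sum using (inj₁; inj₂)
open import Function using (flip)
open import Algebra.Properties.CommutativeSemigroup +-commutativeSemigroup
  using (interchange; x∙yz≈y∙xz)
open import Relation.Nullary using (yes; no; contradiction)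
open import Relation.Binary.PropositionalEquality

∑< : ℕ → (ℕ → ℕ) → ℕ
∑< zero    f = 0
∑< (suc n) f = f 0 + ∑< n (λ i → f (suc i))

syntax ∑< n (λ i → e) = ∑[ i < n ] e

∑-cong : ∀ n {f g : ℕ → ℕ} → (∀ i → i < n → f i ≡ g i) → ∑< n f ≡ ∑< n g
∑-cong zero    eq = refl
∑-cong (suc n) eq = cong₂ _+_ (eq 0 z<s) (∑-cong n (λ i i<n → eq (suc i) (s<s i<n)))

∑-distrib-+ : ∀ n (f g : ℕ → ℕ) → ∑[ i < n ] (f i + g i) ≡ ∑< n f + ∑< n g
∑-distrib-+ zero    f g = refl
∑-distrib-+ (suc n) f g =
  trans (cong (f 0 + g 0 +_) (∑-distrib-+ n _ _)) (interchange (f 0) (g 0) _ _)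

∑-init-last : ∀ n (f : ℕ → ℕ) → ∑< (suc n) f ≡ ∑< n f + f n
∑-init-last zero    f = +-comm (f 0) 0
∑-init-last (suc n) f =
  trans (cong (f 0 +_) (∑-init-last n (λ i → f (suc i)))) (sym (+-assoc (f 0) _ _))

∑-reflect : ∀ n → ∑[ i < n ] (n ∸ suc i) ≡ ∑[ i < n ] i
∑-reflect zero    = refl
∑-reflect (suc n) = begin
  n + ∑[ i < n ] (n ∸ suc i) ≡⟨ cong (n +_) (∑-reflect n) ⟩
  n + ∑[ i < n ] i           ≡⟨ +-comm n _ ⟩
  ∑[ i < n ] i + n           ≡⟨ ∑-init-last n (λ i → i) ⟨
  ∑[ i < suc n ] i           ∎
  where open ≡-Reasoning

∑-+-reflect : ∀ n (f : ℕ → ℕ) → ∑[ i < n ] (f i + i) ≡ ∑[ i < n ] ((f i + n) ∸ suc i)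
∑-+-reflect n f = begin
  ∑[ i < n ] (f i + i)                ≡⟨ ∑-distrib-+ n f (λ i → i) ⟩
  ∑< n f + ∑[ i < n ] i               ≡⟨ cong (∑< n f +_) (∑-reflect n) ⟨
  ∑< n f + ∑[ i < n ] (n ∸ suc i)     ≡⟨ ∑-distrib-+ n f (λ i → n ∸ suc i) ⟨
  ∑[ i < n ] (f i + (n ∸ suc i))      ≡⟨ ∑-cong n (λ i i<n → +-∸-assoc (f i) i<n) ⟨
  ∑[ i < n ] ((f i + n) ∸ suc i)      ∎
  where open ≡-Reasoning

∸-convex : ∀ {p q} u → p ≤ q → (suc p ∸ u) + (q ∸ u) ≤ (p ∸ u) + (suc q ∸ u)
∸-convex {p} {q} zero    p≤q = ≤-reflexive (sym (+-suc p q))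
∸-convex {zero} {q} (suc u) p≤q rewrite 0∸n≡0 u = ∸-monoʳ-≤ q (n≤1+n u)
∸-convex {suc p} {suc q} (suc u) (s≤s p≤q) = ∸-convex u p≤q

-- Spreading n units from the value b + n over the values x i ≥ b + i, one unit each,
-- cannot decrease the excess, by convexity of (_∸ u).
∑-∸-transfer : ∀ n b (x : ℕ → ℕ) u → (∀ i → i < n → b + i ≤ x i) →
               ((b + n) ∸ u) + ∑[ i < n ] (x i ∸ u) ≤ (b ∸ u) + ∑[ i < n ] (suc (x i) ∸ u)
∑-∸-transfer zero    b x u _  = ≤-reflexive (cong (λ m → (m ∸ u) + 0) (+-identityʳ b))
∑-∸-transfer (suc n) b x u le = begin
  ((b + suc n) ∸ u) + ((x 0 ∸ u) + R)       ≡⟨ cong (λ m → (m ∸ u) + ((x 0 ∸ u) + R)) (+-suc b n) ⟩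
  ((suc b + n) ∸ u) + ((x 0 ∸ u) + R)       ≡⟨ x∙yz≈y∙xz _ (x 0 ∸ u) R ⟩
  (x 0 ∸ u) + (((suc b + n) ∸ u) + R)       ≤⟨ +-monoʳ-≤ (x 0 ∸ u) (∑-∸-transfer n (suc b) _ u le′) ⟩
  (x 0 ∸ u) + ((suc b ∸ u) + R′)            ≡⟨ sym (+-assoc (x 0 ∸ u) _ R′) ⟩
  ((x 0 ∸ u) + (suc b ∸ u)) + R′            ≡⟨ cong (_+ R′) (+-comm (x 0 ∸ u) _) ⟩
  ((suc b ∸ u) + (x 0 ∸ u)) + R′            ≤⟨ +-monoˡ-≤ R′ (∸-convex u b≤x₀) ⟩
  ((b ∸ u) + (suc (x 0) ∸ u)) + R′          ≡⟨ +-assoc (b ∸ u) _ R′ ⟩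
  (b ∸ u) + ((suc (x 0) ∸ u) + R′)          ∎
  where
  open ≤-Reasoning
  R  = ∑[ i < n ] (x (suc i) ∸ u)
  R′ = ∑[ i < n ] (suc (x (suc i)) ∸ u)
  b≤x₀ : b ≤ x 0
  b≤x₀ = ≤-trans (≤-reflexive (sym (+-identityʳ b))) (le 0 z<s)
  le′ : ∀ i → i < n → suc b + i ≤ x (suc i)
  le′ i i<n = ≤-trans (≤-reflexive (sym (+-suc b i))) (le (suc i) (s<s i<n))

∑-∸-rearrangement : ∀ n (f : ℕ → ℕ) u → (∀ i j → i ≤ j → j < n → f j ≤ f i) →
                    ∑[ i < n ] ((f i + i) ∸ u) ≤ ∑[ i < n ] (((f i + n) ∸ suc i) ∸ u)
∑-∸-rearrangement zero    f u _       = z≤n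
∑-∸-rearrangement (suc n) f u antitone = begin
  ∑[ i < suc n ] ((f i + i) ∸ u)
    ≡⟨ ∑-init-last n _ ⟩
  ∑[ i < n ] ((f i + i) ∸ u) + ((f n + n) ∸ u)
    ≡⟨ +-comm _ ((f n + n) ∸ u) ⟩
  ((f n + n) ∸ u) + ∑[ i < n ] ((f i + i) ∸ u)
    ≤⟨ ∑-∸-transfer n (f n) (λ i → f i + i) u fₙ+i≤fᵢ+i ⟩
  (f n ∸ u) + ∑[ i < n ] ((suc (f i) + i) ∸ u)
    ≤⟨ +-monoʳ-≤ (f n ∸ u) (∑-∸-rearrangement n (λ i → suc (f i)) u antitone′) ⟩
  (f n ∸ u) + ∑[ i < n ] (((suc (f i) + n) ∸ suc i) ∸ u)
    ≡⟨ +-comm (f n ∸ u) _ ⟩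
  ∑[ i < n ] (((suc (f i) + n) ∸ suc i) ∸ u) + (f n ∸ u)
    ≡⟨ cong₂ _+_ (∑-cong n (λ i _ → cong (λ m → (m ∸ suc i) ∸ u) (sym (+-suc (f i) n))))
                 (cong (_∸ u) (sym (m+n∸n≡m (f n) (suc n)))) ⟩
  ∑[ i < n ] (((f i + suc n) ∸ suc i) ∸ u) + (((f n + suc n) ∸ suc n) ∸ u)
    ≡⟨ ∑-init-last n _ ⟨
  ∑[ i < suc n ] (((f i + suc n) ∸ suc i) ∸ u) ∎
  where
  open ≤-Reasoning
  fₙ+i≤fᵢ+i : ∀ i → i < n → f n + i ≤ f i + i
  fₙ+i≤fᵢ+i i i<n = +-monoˡ-≤ i (antitone i n (<⇒≤ i<n) ≤-refl)
  antitone′ : ∀ i j → i ≤ j → j < n → suc (f j) ≤ suc (f i)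
  antitone′ i j i≤j j<n = s≤s (antitone i j i≤j (m≤n⇒m≤1+n j<n))

module _ {A : Set} {R : A → A → Set} where

  reverseAcc⁺ : ∀ {x xs acc} → Linked R (x ∷ xs) → Linked (flip R) (x ∷ acc) →
                Linked (flip R) (reverseAcc (x ∷ acc) xs)
  reverseAcc⁺ [-]     racc = racc
  reverseAcc⁺ (r ∷ l) racc = reverseAcc⁺ l (r ∷ racc)

  reverse⁺ : ∀ {xs} → Linked R xs → Linked (flip R) (reverse xs)
  reverse⁺ []        = []
  reverse⁺ {_ ∷ _} l = reverseAcc⁺ l [-]

descending⇒≤head : ∀ {x xs} → Linked _≥_ (x ∷ xs) → All (_≤ x) (x ∷ xs)
descending⇒≤head = Linked.Linked⇒All (λ y≤x z≤y → ≤-trans z≤y y≤x) ≤-refl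

open SortingAlgorithm mergeSort using (sort; sort-↭; sort-↗)

sortDesc-↭ : ∀ xs → sortDesc xs ↭ xs
sortDesc-↭ xs = ↭-trans (↭-reverse (sort xs)) (sort-↭ xs)

sortDesc-descending : ∀ xs → Linked _≥_ (sortDesc xs)
sortDesc-descending xs = reverse⁺ (sort-↗ xs)

excess : ℕ → List ℕ → ℕ
excess t xs = sum (map (_∸ t) xs)

excess-0 : ∀ xs → excess 0 xs ≡ sum xs
excess-0 xs = cong sum (map-id xs)

excess-↭ : ∀ t {xs ys} → xs ↭ ys → excess t xs ≡ excess t ys
excess-↭ t p = sum-↭ (map⁺ (_∸ t) p)

excess-bounded : ∀ {t xs} → All (_≤ t) xs → excess t xs ≡ 0
excess-bounded []           = refl
excess-bounded (x≤t ∷ xs≤t) = cong₂ _+_ (m≤n⇒m∸n≡0 x≤t) (excess-bounded xs≤t)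

sum-take≤ : ∀ k t xs → sum (take k xs) ≤ k * t + excess t xs
sum-take≤ zero    t xs       = z≤n
sum-take≤ (suc k) t []       = z≤n
sum-take≤ (suc k) t (x ∷ xs) = begin
  x + sum (take k xs)                        ≤⟨ +-mono-≤ (m≤n+m∸n x t) (sum-take≤ k t xs) ⟩
  (t + (x ∸ t)) + (k * t + excess t xs)      ≡⟨ interchange t (x ∸ t) (k * t) _ ⟩
  (t + k * t) + ((x ∸ t) + excess t xs)      ∎
  where open ≤-Reasoning

-- On a descending list the bound of sum-take≤ is attained at t = the entry right after the prefix.
sum-take-attained : ∀ {a as} → Linked _≥_ (a ∷ as) → ∀ k → k ≤ length as →
                    ∃[ t ] t ≤ a × sum (take k (a ∷ as)) ≡ k * t + excess t (a ∷ as)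
sum-take-attained {a} desc zero _ with descending⇒≤head desc
... | _ ∷ as≤a = a , ≤-refl , sym (cong₂ _+_ (n∸n≡0 a) (excess-bounded as≤a))
sum-take-attained {a} {b ∷ as} (b≤a ∷ desc) (suc k) (s≤s k≤) with sum-take-attained desc k k≤
... | t , t≤b , eq = t , t≤a , (begin
  a + sum (take k (b ∷ as))                    ≡⟨ cong₂ _+_ (sym (m+[n∸m]≡n t≤a)) eq ⟩
  (t + (a ∸ t)) + (k * t + excess t (b ∷ as))  ≡⟨ interchange t (a ∸ t) (k * t) _ ⟩
  (t + k * t) + ((a ∸ t) + excess t (b ∷ as))  ∎)
  where
  open ≡-Reasoning
  t≤a = ≤-trans t≤b b≤a

sum-take-descending : ∀ {xs} → Linked _≥_ xs → ∀ k → k < length xs →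
                      ∃[ t ] sum (take k xs) ≡ k * t + excess t xs
sum-take-descending {_ ∷ _} desc k (s≤s k≤) = map₂ proj₂ (sum-take-attained desc k k≤)

excess-dominance⇒Majorizes : ∀ A B → length A ≡ length B → sum A ≡ sum B →
                             (∀ t → excess t B ≤ excess t A) → Majorizes A B
excess-dominance⇒Majorizes A B |A|≡|B| ΣA≡ΣB dominance = |A|≡|B| , prefix , ΣA≡ΣB
  where
  prefix : ∀ k → k < length A → sum (take k (sortDesc B)) ≤ sum (take k (sortDesc A))
  prefix k k<|A| with sum-take-descending (sortDesc-descending A) k
                        (subst (k <_) (sym (↭-length (sortDesc-↭ A))) k<|A|)
  ... | t , eq = begin
    sum (take k (sortDesc B))          ≤⟨ sum-take≤ k t (sortDesc B) ⟩
    k * t + excess t (sortDesc B)      ≡⟨ cong (k * t +_) (excess-↭ t (sortDesc-↭ B)) ⟩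
    k * t + excess t B                 ≤⟨ +-monoʳ-≤ (k * t) (dominance t) ⟩
    k * t + excess t A                 ≡⟨ cong (k * t +_) (excess-↭ t (sortDesc-↭ A)) ⟨
    k * t + excess t (sortDesc A)      ≡⟨ eq ⟨
    sum (take k (sortDesc A))          ∎
    where open ≤-Reasoning

sum-map-applyUpTo : ∀ {A : Set} (h : A → ℕ) (f : ℕ → A) n →
                    sum (map h (applyUpTo f n)) ≡ ∑[ i < n ] h (f i)
sum-map-applyUpTo h f zero    = refl
sum-map-applyUpTo h f (suc n) = cong (h (f 0) +_) (sum-map-applyUpTo h (λ i → f (suc i)) n)

sum-concatMap : ∀ {A : Set} (G : A → List ℕ) xs → sum (concatMap G xs) ≡ sum (map (λ x → sum (G x)) xs)
sum-concatMap G []       = refl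
sum-concatMap G (x ∷ xs) = trans (sum-++ (G x) _) (cong (sum (G x) +_) (sum-concatMap G xs))

dropColumn : List ℕ → List ℕ
dropColumn = map pred

-- Rows and columns are 0-indexed here: g i j is the weight of the square (i + 1 , j + 1).
cellSum : (ℕ → ℕ → ℕ) → List ℕ → ℕ
cellSum g λs = ∑[ i < length λs ] ∑[ j < part λs (suc i) ] g i j

firstCell : (ℕ → ℕ) → ℕ → ℕ
firstCell h zero    = 0
firstCell h (suc y) = h (suc y)

firstColumnSum : (ℕ → ℕ → ℕ) → List ℕ → ℕ
firstColumnSum h λs = ∑[ i < length λs ] firstCell (h i) (part λs (suc i))

sum-map-cells : ∀ (f : ℕ × ℕ → ℕ) λs → sum (map f (cells λs)) ≡ cellSum (λ i j → f (suc i , suc j)) λs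
sum-map-cells f λs = begin
  sum (map f (cells λs))
    ≡⟨ cong sum (map-concatMap f row (upTo (length λs))) ⟩
  sum (concatMap (λ i → map f (row i)) (upTo (length λs)))
    ≡⟨ sum-concatMap _ (upTo (length λs)) ⟩
  sum (map (λ i → sum (map f (row i))) (upTo (length λs)))
    ≡⟨ sum-map-applyUpTo _ (λ i → i) (length λs) ⟩
  ∑[ i < length λs ] sum (map f (row i))
    ≡⟨ ∑-cong (length λs) (λ i _ → trans (cong sum (sym (map-∘ (upTo (part λs (suc i))))))
                                          (sum-map-applyUpTo _ (λ j → j) (part λs (suc i)))) ⟩
  cellSum (λ i j → f (suc i , suc j)) λs ∎
  where
  open ≡-Reasoning
  row : ℕ → List (ℕ × ℕ)
  row i = map (λ j → (suc i , suc j)) (upTo (part λs (suc i)))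

cellSum-cong : ∀ λs {g g′ : ℕ → ℕ → ℕ} → (∀ i j → j < part λs (suc i) → g i j ≡ g′ i j) →
               cellSum g λs ≡ cellSum g′ λs
cellSum-cong λs eq = ∑-cong (length λs) (λ i _ → ∑-cong (part λs (suc i)) (eq i))

cellSum-empty : ∀ {λs} g → All (_≤ 0) λs → cellSum g λs ≡ 0
cellSum-empty g []          = refl
cellSum-empty g (z≤n ∷ ≤0) = cellSum-empty (λ i → g (suc i)) ≤0

firstColumnSum-empty : ∀ {λs} h → All (_≤ 0) λs → firstColumnSum h λs ≡ 0
firstColumnSum-empty h []          = refl
firstColumnSum-empty h (z≤n ∷ ≤0) = firstColumnSum-empty (λ i → h (suc i)) ≤0

conjPart-empty : ∀ {λs} j → All (_≤ 0) λs → conjPart λs (suc j) ≡ 0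
conjPart-empty j []          = refl
conjPart-empty j (z≤n ∷ ≤0) = conjPart-empty j ≤0

conjPart-∷-≤ : ∀ {j} x xs → j ≤ x → conjPart (x ∷ xs) j ≡ suc (conjPart xs j)
conjPart-∷-≤ {j} x xs j≤x with j ≤? x
... | yes _   = refl
... | no j≰x = contradiction j≤x j≰x

conjPart-∷-< : ∀ {j} x xs → x < j → conjPart (x ∷ xs) j ≡ conjPart xs j
conjPart-∷-< {j} x xs x<j with j ≤? x
... | yes j≤x = contradiction j≤x (<⇒≱ x<j)
... | no _    = refl

part-dropColumn : ∀ λs i → part (dropColumn λs) i ≡ pred (part λs i)
part-dropColumn []       i             = refl
part-dropColumn (x ∷ λs) zero          = refl
part-dropColumn (x ∷ λs) (suc zero)    = refl
part-dropColumn (x ∷ λs) (suc (suc i)) = part-dropColumn λs (suc i)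

conjPart-dropColumn : ∀ λs j → conjPart (dropColumn λs) (suc j) ≡ conjPart λs (suc (suc j))
conjPart-dropColumn []             j = refl
conjPart-dropColumn (zero ∷ λs)    j = conjPart-dropColumn λs j
conjPart-dropColumn (suc x ∷ λs) j with ≤-<-connex (suc j) x
... | inj₁ j<x = begin
  conjPart (x ∷ dropColumn λs) (suc j)    ≡⟨ conjPart-∷-≤ x _ j<x ⟩
  suc (conjPart (dropColumn λs) (suc j))  ≡⟨ cong suc (conjPart-dropColumn λs j) ⟩
  suc (conjPart λs (suc (suc j)))       ≡⟨ conjPart-∷-≤ (suc x) λs (s≤s j<x) ⟨
  conjPart (suc x ∷ λs) (suc (suc j))   ∎
  where open ≡-Reasoning
... | inj₂ x≤j = begin
  conjPart (x ∷ dropColumn λs) (suc j)    ≡⟨ conjPart-∷-< x _ x≤j ⟩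
  conjPart (dropColumn λs) (suc j)        ≡⟨ conjPart-dropColumn λs j ⟩
  conjPart λs (suc (suc j))             ≡⟨ conjPart-∷-< (suc x) λs (s≤s x≤j) ⟨
  conjPart (suc x ∷ λs) (suc (suc j))   ∎
  where open ≡-Reasoning

cellSum-dropColumn : ∀ (g g′ h : ℕ → ℕ → ℕ) λs →
                     (∀ i y → ∑[ j < y ] g i j ≡ ∑[ j < pred y ] g′ i j + firstCell (h i) y) →
                     cellSum g λs ≡ cellSum g′ (dropColumn λs) + firstColumnSum h λs
cellSum-dropColumn g g′ h λs splitRow = begin
  cellSum g λs
    ≡⟨ ∑-cong (length λs) (λ i _ → splitRow i (part λs (suc i))) ⟩
  ∑[ i < length λs ] (∑[ j < pred (part λs (suc i)) ] g′ i j + firstCell (h i) (part λs (suc i)))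
    ≡⟨ ∑-distrib-+ (length λs) _ _ ⟩
  ∑[ i < length λs ] ∑[ j < pred (part λs (suc i)) ] g′ i j + firstColumnSum h λs
    ≡⟨ cong (_+ firstColumnSum h λs) (sym dropped) ⟩
  cellSum g′ (dropColumn λs) + firstColumnSum h λs ∎
  where
  open ≡-Reasoning
  dropped : cellSum g′ (dropColumn λs) ≡ ∑[ i < length λs ] ∑[ j < pred (part λs (suc i)) ] g′ i j
  dropped = trans (cong (λ n → ∑[ i < n ] ∑[ j < part (dropColumn λs) (suc i) ] g′ i j)
                        (length-map pred λs))
                  (∑-cong (length λs) (λ i _ → cong (λ y → ∑< y (g′ i)) (part-dropColumn λs (suc i))))

firstColumnSum-descending : ∀ {λs} h → Linked _≥_ λs →
                            firstColumnSum h λs ≡ ∑[ i < conjPart λs 1 ] h i (part λs (suc i))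
firstColumnSum-descending {[]}         h _    = refl
firstColumnSum-descending {zero ∷ λs}  h desc with descending⇒≤head desc
... | _ ∷ λs≤0 rewrite conjPart-empty 0 λs≤0 = firstColumnSum-empty (λ i → h (suc i)) λs≤0
firstColumnSum-descending {suc x ∷ λs} h desc =
  cong (h 0 (suc x) +_) (firstColumnSum-descending (λ i → h (suc i)) (Linked.tail desc))

part-antitone : ∀ {λs} → Linked _≥_ λs → ∀ i j → i ≤ j → part λs (suc j) ≤ part λs (suc i)
part-antitone []           _       _       _         = z≤n
part-antitone [-]          zero    zero    _         = ≤-refl
part-antitone [-]          _       (suc j) _         = z≤n
part-antitone (_   ∷ _)    zero    zero    _         = ≤-refl
part-antitone (y≤x ∷ desc) zero    (suc j) _         = ≤-trans (part-antitone desc zero j z≤n) y≤x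
part-antitone (_   ∷ desc) (suc i) (suc j) (s≤s i≤j) = part-antitone desc i j i≤j

dropColumn-descending : ∀ {λs} → Linked _≥_ λs → Linked _≥_ (dropColumn λs)
dropColumn-descending desc = Linked.map⁺ (Linked.map pred-mono-≤ desc)

dropColumn-bounded : ∀ {n λs} → All (_≤ suc n) λs → All (_≤ n) (dropColumn λs)
dropColumn-bounded ≤n = All.map⁺ (All.map pred-mono-≤ ≤n)

descending-bounded : ∀ {λs} → Linked _≥_ λs → All (_≤ part λs 1) λs
descending-bounded {[]}    []   = []
descending-bounded {_ ∷ _} desc = descending⇒≤head desc

hookAt : List ℕ → ℕ → ℕ → ℕ
hookAt λs i j = hook λs (suc i , suc j)

hookAt-dropColumn : ∀ λs i j → j < part (dropColumn λs) (suc i) →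
                    hookAt λs i (suc j) ≡ hookAt (dropColumn λs) i j
hookAt-dropColumn λs i j j<μᵢ
  rewrite part-dropColumn λs (suc i) | conjPart-dropColumn λs j = shift (part λs (suc i)) j<μᵢ
  where
  c = conjPart λs (suc (suc j))
  shift : ∀ p → j < pred p → (p + c + 1) ∸ (suc i + suc (suc j)) ≡ (pred p + c + 1) ∸ (suc i + suc j)
  shift (suc p) _ = cong ((p + c + 1) ∸_) (+-suc i (suc j))

hookAt-firstColumn : ∀ λs i → hookAt λs i 0 ≡ (part λs (suc i) + conjPart λs 1) ∸ suc i
hookAt-firstColumn λs i rewrite +-comm (part λs (suc i) + conjPart λs 1) 1 | +-comm i 1 = refl

hookExcess antiHookExcess : ℕ → List ℕ → ℕ
hookExcess     t λs = cellSum (λ i j → hookAt λs i j ∸ t) λs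
antiHookExcess t λs = cellSum (λ i j → suc (i + j) ∸ t) λs

excess-hooks : ∀ t λs → excess t (hooks λs) ≡ hookExcess t λs
excess-hooks t λs = trans (cong sum (sym (map-∘ (cells λs)))) (sum-map-cells _ λs)

excess-antiHooks : ∀ t λs → excess t (antiHooks λs) ≡ antiHookExcess t λs
excess-antiHooks t λs = trans (cong sum (sym (map-∘ (cells λs))))
  (trans (sum-map-cells _ λs) (cellSum-cong λs (λ i j _ → cong (_∸ t) (+-suc i j))))

hookExcess-dropColumn : ∀ t λs → hookExcess t λs ≡
  hookExcess t (dropColumn λs) + firstColumnSum (λ i _ → hookAt λs i 0 ∸ t) λs
hookExcess-dropColumn t λs =
  trans (cellSum-dropColumn (λ i j → hookAt λs i j ∸ t) (λ i j → hookAt λs i (suc j) ∸ t)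
                            (λ i _ → hookAt λs i 0 ∸ t) λs splitRow)
        (cong (_+ firstColumnSum (λ i _ → hookAt λs i 0 ∸ t) λs)
              (cellSum-cong (dropColumn λs) (λ i j j<μᵢ → cong (_∸ t) (hookAt-dropColumn λs i j j<μᵢ))))
  where
  splitRow : ∀ i y → ∑[ j < y ] (hookAt λs i j ∸ t) ≡
             ∑[ j < pred y ] (hookAt λs i (suc j) ∸ t) + firstCell (λ _ → hookAt λs i 0 ∸ t) y
  splitRow i zero    = refl
  splitRow i (suc y) = +-comm (hookAt λs i 0 ∸ t) _

-- y + i is the anti-hook of the last square of the row i, of length y.
antiHookExcess-dropColumn : ∀ t λs → antiHookExcess t λs ≡
  antiHookExcess t (dropColumn λs) + firstColumnSum (λ i y → (y + i) ∸ t) λs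
antiHookExcess-dropColumn t λs =
  cellSum-dropColumn (λ i j → suc (i + j) ∸ t) (λ i j → suc (i + j) ∸ t) (λ i y → (y + i) ∸ t)
                     λs splitRow
  where
  splitRow : ∀ i y → ∑[ j < y ] (suc (i + j) ∸ t) ≡
             ∑[ j < pred y ] (suc (i + j) ∸ t) + firstCell (λ y → (y + i) ∸ t) y
  splitRow i zero    = refl
  splitRow i (suc y) = trans (∑-init-last y _)
                             (cong (λ m → ∑[ j < y ] (suc (i + j) ∸ t) + (suc m ∸ t)) (+-comm i y))

lastCells≤firstColumnHooks : ∀ {λs} → Linked _≥_ λs → ∀ t →
  firstColumnSum (λ i y → (y + i) ∸ t) λs ≤ firstColumnSum (λ i _ → hookAt λs i 0 ∸ t) λs
lastCells≤firstColumnHooks {λs} desc t = begin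
  firstColumnSum (λ i y → (y + i) ∸ t) λs
    ≡⟨ firstColumnSum-descending _ desc ⟩
  ∑[ i < ℓ ] ((part λs (suc i) + i) ∸ t)
    ≤⟨ ∑-∸-rearrangement ℓ _ t (λ i j i≤j _ → part-antitone desc i j i≤j) ⟩
  ∑[ i < ℓ ] (((part λs (suc i) + ℓ) ∸ suc i) ∸ t)
    ≡⟨ ∑-cong ℓ (λ i _ → cong (_∸ t) (hookAt-firstColumn λs i)) ⟨
  ∑[ i < ℓ ] (hookAt λs i 0 ∸ t)
    ≡⟨ firstColumnSum-descending _ desc ⟨
  firstColumnSum (λ i _ → hookAt λs i 0 ∸ t) λs ∎
  where
  open ≤-Reasoning
  ℓ = conjPart λs 1

lastCells≡firstColumnHooks : ∀ {λs} → Linked _≥_ λs →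
  firstColumnSum (λ i y → y + i) λs ≡ firstColumnSum (λ i _ → hookAt λs i 0) λs
lastCells≡firstColumnHooks {λs} desc = begin
  firstColumnSum (λ i y → y + i) λs              ≡⟨ firstColumnSum-descending _ desc ⟩
  ∑[ i < ℓ ] (part λs (suc i) + i)                ≡⟨ ∑-+-reflect ℓ _ ⟩
  ∑[ i < ℓ ] ((part λs (suc i) + ℓ) ∸ suc i)      ≡⟨ ∑-cong ℓ (λ i _ → hookAt-firstColumn λs i) ⟨
  ∑[ i < ℓ ] hookAt λs i 0                        ≡⟨ firstColumnSum-descending _ desc ⟨
  firstColumnSum (λ i _ → hookAt λs i 0) λs      ∎
  where
  open ≡-Reasoning
  ℓ = conjPart λs 1

antiHookExcess≤hookExcess : ∀ n {λs} → Linked _≥_ λs → All (_≤ n) λs → ∀ t →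
                            antiHookExcess t λs ≤ hookExcess t λs
antiHookExcess≤hookExcess zero    desc ≤0 t =
  ≤-reflexive (trans (cellSum-empty _ ≤0) (sym (cellSum-empty _ ≤0)))
antiHookExcess≤hookExcess (suc n) {λs} desc ≤n t = begin
  antiHookExcess t λs
    ≡⟨ antiHookExcess-dropColumn t λs ⟩
  antiHookExcess t (dropColumn λs) + firstColumnSum (λ i y → (y + i) ∸ t) λs
    ≤⟨ +-mono-≤ (antiHookExcess≤hookExcess n (dropColumn-descending desc) (dropColumn-bounded ≤n) t)
                 (lastCells≤firstColumnHooks desc t) ⟩
  hookExcess t (dropColumn λs) + firstColumnSum (λ i _ → hookAt λs i 0 ∸ t) λs
    ≡⟨ hookExcess-dropColumn t λs ⟨
  hookExcess t λs ∎
  where open ≤-Reasoning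

antiHookExcess₀≡hookExcess₀ : ∀ n {λs} → Linked _≥_ λs → All (_≤ n) λs →
                              antiHookExcess 0 λs ≡ hookExcess 0 λs
antiHookExcess₀≡hookExcess₀ zero    desc ≤0 = trans (cellSum-empty _ ≤0) (sym (cellSum-empty _ ≤0))
antiHookExcess₀≡hookExcess₀ (suc n) {λs} desc ≤n = begin
  antiHookExcess 0 λs
    ≡⟨ antiHookExcess-dropColumn 0 λs ⟩
  antiHookExcess 0 (dropColumn λs) + firstColumnSum (λ i y → y + i) λs
    ≡⟨ cong₂ _+_ (antiHookExcess₀≡hookExcess₀ n (dropColumn-descending desc) (dropColumn-bounded ≤n))
                 (lastCells≡firstColumnHooks desc) ⟩
  hookExcess 0 (dropColumn λs) + firstColumnSum (λ i _ → hookAt λs i 0) λs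
    ≡⟨ hookExcess-dropColumn 0 λs ⟨
  hookExcess 0 λs ∎
  where open ≡-Reasoning

theorem3p3 : (λs : List ℕ) → IsPartition λs → Majorizes (hooks λs) (antiHooks λs)
theorem3p3 λs (desc , _) =
  excess-dominance⇒Majorizes (hooks λs) (antiHooks λs) sameLength sameSum dominance
  where
  sameLength : length (hooks λs) ≡ length (antiHooks λs)
  sameLength = trans (length-map (hook λs) (cells λs)) (sym (length-map antiHook (cells λs)))
  sameSum : sum (hooks λs) ≡ sum (antiHooks λs)
  sameSum = begin
    sum (hooks λs)           ≡⟨ excess-0 (hooks λs) ⟨
    excess 0 (hooks λs)      ≡⟨ excess-hooks 0 λs ⟩
    hookExcess 0 λs          ≡⟨ antiHookExcess₀≡hookExcess₀ _ desc (descending-bounded desc) ⟨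
    antiHookExcess 0 λs      ≡⟨ excess-antiHooks 0 λs ⟨
    excess 0 (antiHooks λs)  ≡⟨ excess-0 (antiHooks λs) ⟩
    sum (antiHooks λs)       ∎
    where open ≡-Reasoning
  dominance : ∀ t → excess t (antiHooks λs) ≤ excess t (hooks λs)
  dominance t = begin
    excess t (antiHooks λs)  ≡⟨ excess-antiHooks t λs ⟩
    antiHookExcess t λs      ≤⟨ antiHookExcess≤hookExcess _ desc (descending-bounded desc) t ⟩
    hookExcess t λs          ≡⟨ excess-hooks t λs ⟨
    excess t (hooks λs)      ∎
    where open ≤-Reasoning
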